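{- There exists a deterministic weak-probe local computation algorithm for weak $3$-coloring that, on every input graph with $n$ vertices and for every queried vertex, uses at most $\log^* n + O(1)$ weak probes.
   Context: The input is a simple undirected graph $G=(V,E)$ with $n$ vertices carrying distinct IDs, represented as an array with one row per vertex $v$: cell $(v,0)$ holds the degree $d_v$, cell $(v,j)$ for $1\le j\le d_v$ holds the ID of the neighbor at $v$'s $j$-th port (ports in arbitrary order). A weak probe specifies a single cell $(v,j)$ and returns its content. A deterministic local computation algorithm (LCA) receives a query (here a vertex $v$), makes probes to the input, and returns an answer (here a color for $v$); its answers to all possible queries must be consistent with a single global feasible solution. Its probe complexity is the maximum number of probes used to answer a query. A weak $c$-coloring is a map $col:V\to\{1,\dots,c\}$ such that every non-isolated vertex $v$ has a neighbor $u$ with $col(u)\ne col(v)$. -}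

module Defs where

open import Data.Nat using (ℕ; zero; suc; _≤_; _+_; _∸_)
open import Data.Nat.Logarithm using (⌊log₂_⌋)
open import Data.Fin using (Fin; toℕ)
open import Data.Maybe using (Maybe; just; nothing)
open import Data.Product using (Σ; ∃; _×_; _,_)
open import Relation.Binary.PropositionalEquality using (_≡_; _≢_)
import Data.Nat
import Data.Fin
import Relation.Nullary

-- Iterated logarithm  log* n = least k such that applying ⌊log₂⌋ k times
-- to n yields a value ≤ 1.  Fuel n suffices since ⌊log₂ m⌋ < m for m ≥ 2.

logStar-fuel : ℕ → ℕ → ℕ
logStar-fuel zero    m = zero
logStar-fuel (suc f) zero = zero
logStar-fuel (suc f) (suc zero) = zero
logStar-fuel (suc f) m@(suc (suc _)) = suc (logStar-fuel f ⌊log₂ m ⌋)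

log* : ℕ → ℕ
log* n = logStar-fuel n n

-- Simple undirected graphs on the vertex set Fin n; the vertex v : Fin n
-- is also its (distinct) ID.  Row v of the input array: cell (v,0) is
-- the degree deg v, cell (v, 1+j) is the ID of the neighbour at port j
-- (ports numbered 0 .. deg v - 1 internally, in arbitrary order).

record Graph (n : ℕ) : Set where
  field
    deg     : Fin n → ℕ
    nbr     : (v : Fin n) → Fin (deg v) → Fin n
    nbr-inj : ∀ v (i j : Fin (deg v)) → nbr v i ≡ nbr v j → i ≡ j
    no-loop : ∀ v (i : Fin (deg v)) → nbr v i ≢ v
    sym-adj : ∀ v (i : Fin (deg v)) → ∃ λ (k : Fin (deg (nbr v i))) → nbr (nbr v i) k ≡ v

open Graph public

cell : ∀ {n} → Graph n → Fin n → ℕ → Maybe ℕ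
cell G v zero = just (deg G v)
cell G v (suc j) with Data.Nat._<?_ j (deg G v)
... | Relation.Nullary.yes p = just (toℕ (nbr G v (Data.Fin.fromℕ< p)))
... | Relation.Nullary.no  _ = nothing

-- Deterministic weak-probe algorithms (for a fixed n) answering with a
-- value in A: adaptive decision trees whose internal nodes are weak
-- probes of a single cell (v , j) and whose next step may depend
-- arbitrarily on the answer.

data ProbeTree (n : ℕ) (A : Set) : Set where
  answer : A → ProbeTree n A
  probe  : Fin n → ℕ → (Maybe ℕ → ProbeTree n A) → ProbeTree n A

run : ∀ {n A} → ProbeTree n A → Graph n → A
run (answer a)    G = a
run (probe v j k) G = run (k (cell G v j)) G

probes : ∀ {n A} → ProbeTree n A → Graph n → ℕ
probes (answer a)    G = zero
probes (probe v j k) G = suc (probes (k (cell G v j)) G)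

ColoringLCA : ℕ → Set
ColoringLCA c = (n : ℕ) → Fin n → ProbeTree n (Fin c)

-- The global colouring produced by the LCA on G (consistency is automatic:
-- the answers to all queries define this single colouring).
lcaColoring : ∀ {c n} → ColoringLCA c → Graph n → Fin n → Fin c
lcaColoring {n = n} L G v = run (L n v) G

IsWeakColoring : ∀ {n c} → Graph n → (Fin n → Fin c) → Set
IsWeakColoring {n} G col =
  ∀ (v : Fin n) → deg G v ≢ 0 → ∃ λ (i : Fin (deg G v)) → col (nbr G v i) ≢ col v

module Submission where

-- Every non-isolated vertex u points to its successor, the neighbour at
-- its first port; repeatedly following successors from v gives the trail
-- of v, whose sequence of IDs is a stream in which consecutive entries
-- differ.  It suffices to colour every such stream properly (consecutive
-- colours distinct) by a shift-invariant rule of bounded radius: the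
-- trail of the successor of v is the shifted trail of v, so v and its
-- successor (a neighbour) receive different colours, and a colour that
-- depends on the first W + 1 trail entries costs exactly W probes.

open import Defs
open import Data.Nat using (ℕ; _≤_; _+_)
open import Data.Fin using (Fin)
open import Data.Product using (Σ; ∃; _×_; _,_)

open import Data.Nat using (zero; suc; _*_; _∸_; _^_; _<_; _<?_; _≟_; z≤n; s≤s; _%_; _/_)
open import Data.Nat.Properties
open import Data.Nat.DivMod using (m≡m%n+[m/n]*n; m%n<n; m<n*o⇒m/o<n)
open import Data.Nat.Logarithm using (⌊log₂_⌋; ⌊log₂⌋-mono-≤; ⌊log₂[2*b]⌋≡1+⌊log₂b⌋; ⌊log₂[2^n]⌋≡n)
open import Data.Fin using (zero; suc; toℕ; fromℕ<)
open import Data.Fin.Properties using (toℕ-injective; toℕ<n; toℕ-fromℕ<)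
open import Data.Maybe using (Maybe; just; nothing)
open import Data.Product using (proj₁; proj₂)
open import Data.Empty using (⊥-elim)
open import Relation.Nullary using (yes; no)
open import Data.Nat.Tactic.RingSolver using (solve-∀)
open import Relation.Binary.PropositionalEquality

-- Sequences of IDs or colours along the infinite path 0 — 1 — 2 — ⋯.
Stream : Set
Stream = ℕ → ℕ

shift : Stream → Stream
shift s i = s (suc i)

Proper : ℕ → Stream → Set
Proper B s = ∀ i → s i < B × s i ≢ s (suc i)

proper-mono : ∀ {B B′ s} → B ≤ B′ → Proper B s → Proper B′ s
proper-mono B≤B′ proper i = ≤-trans (proj₁ (proper i)) B≤B′ , proj₂ (proper i)

Agree : ℕ → Stream → Stream → Set
Agree m s t = ∀ i → i ≤ m → s i ≡ t i

-- A window map of radius r computes output i from the inputs i … i + r,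
-- by the same rule at every position (it commutes with the shift).
-- (No eta: comparing two window maps must not expand them field by field.)
record WindowMap (r : ℕ) : Set where
  no-eta-equality
  field
    apply       : Stream → Stream
    local       : ∀ m {s t} → Agree (r + m) s t → Agree m (apply s) (apply t)
    equivariant : ∀ s → apply (shift s) ≗ shift (apply s)

open WindowMap

window-cong : ∀ {r} (F : WindowMap r) {s t} → s ≗ t → apply F s ≗ apply F t
window-cong F s≗t i = local F i (λ j _ → s≗t j) i ≤-refl

window-head : ∀ {r} (F : WindowMap r) {s t} → Agree r s t → apply F s 0 ≡ apply F t 0
window-head {r} F {s} {t} agree =
  local F 0 (subst (λ k → Agree k s t) (sym (+-identityʳ r)) agree) 0 z≤n

identity : WindowMap 0
apply identity s = s
local identity m agree = agree
equivariant identity s i = refl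

infixr 5 _⨾_
_⨾_ : ∀ {r q} → WindowMap r → WindowMap q → WindowMap (r + q)
apply (F ⨾ G) s = apply G (apply F s)
local (_⨾_ {r} {q} F G) m {s} {t} agree =
  local G m (local F (q + m) (subst (λ k → Agree k s t) (+-assoc r q m) agree))
equivariant (F ⨾ G) s i =
  trans (window-cong G (equivariant F s) i) (equivariant G (apply F s) i)

record Recolours {r} (F : WindowMap r) (B C : ℕ) : Set where
  field
    recolour : ∀ {s} → Proper B s → Proper C (apply F s)

open Recolours

recolours-mono : ∀ {r} {F : WindowMap r} {B B′ C C′} → B′ ≤ B → C ≤ C′ →
                 Recolours F B C → Recolours F B′ C′
recolour (recolours-mono B′≤B C≤C′ f) proper = proper-mono C≤C′ (recolour f (proper-mono B′≤B proper))

recolours-⨾ : ∀ {r q} {F : WindowMap r} {G : WindowMap q} {B C D} →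
              Recolours F B C → Recolours G C D → Recolours (F ⨾ G) B D
recolour (recolours-⨾ f g) proper = recolour g (recolour f proper)

slide₂ : (ℕ → ℕ → ℕ) → WindowMap 1
apply (slide₂ f) s i = f (s i) (s (suc i))
local (slide₂ f) m agree i i≤m =
  cong₂ f (agree i (m≤n⇒m≤1+n i≤m)) (agree (suc i) (s≤s i≤m))
equivariant (slide₂ f) s i = refl

slide₃ : (ℕ → ℕ → ℕ → ℕ) → WindowMap 2
apply (slide₃ f) s i = f (s i) (s (suc i)) (s (suc (suc i)))
local (slide₃ f) m agree i i≤m
  rewrite agree i (m≤n⇒m≤1+n (m≤n⇒m≤1+n i≤m))
        | agree (suc i) (s≤s (m≤n⇒m≤1+n i≤m))
        | agree (suc (suc i)) (s≤s (s≤s i≤m)) = refl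
equivariant (slide₃ f) s i = refl

-- If a ≠ b are below 2^k, cvColour k a b = 2i + (bit i of a), where i is
-- the lowest bit position at which a and b differ.
cvColour : ℕ → ℕ → ℕ → ℕ
cvColour zero    a b = 0
cvColour (suc k) a b with a % 2 ≟ b % 2
... | yes _ = 2 + cvColour k (a / 2) (b / 2)
... | no  _ = a % 2

bits-injective : ∀ a b → a % 2 ≡ b % 2 → a / 2 ≡ b / 2 → a ≡ b
bits-injective a b low≡ high≡ = begin
  a                  ≡⟨ m≡m%n+[m/n]*n a 2 ⟩
  a % 2 + a / 2 * 2  ≡⟨ cong₂ (λ x y → x + y * 2) low≡ high≡ ⟩
  b % 2 + b / 2 * 2  ≡⟨ sym (m≡m%n+[m/n]*n b 2) ⟩
  b                  ∎
  where open ≡-Reasoning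

half-< : ∀ {a} k → a < 2 ^ suc k → a / 2 < 2 ^ k
half-< {a} k a< = m<n*o⇒m/o<n (subst (a <_) (*-comm 2 (2 ^ k)) a<)

below-1 : ∀ {a} → a < 1 → a ≡ 0
below-1 (s≤s z≤n) = refl

2+≢bit : ∀ x y → y < 2 → 2 + x ≢ y
2+≢bit x .(2 + x) (s≤s (s≤s ())) refl

cvColour-< : ∀ k a b → a < 2 ^ k → b < 2 ^ k → a ≢ b → cvColour k a b < 2 * k
cvColour-< zero a b a< b< a≢b = ⊥-elim (a≢b (trans (below-1 a<) (sym (below-1 b<))))
cvColour-< (suc k) a b a< b< a≢b with a % 2 ≟ b % 2
... | yes low≡ = subst (2 + cvColour k (a / 2) (b / 2) <_) (sym (*-suc 2 k))
      (+-monoʳ-< 2 (cvColour-< k (a / 2) (b / 2) (half-< k a<) (half-< k b<)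
                      (λ high≡ → a≢b (bits-injective a b low≡ high≡))))
... | no  _    = ≤-trans (m%n<n a 2) (*-monoʳ-≤ 2 (s≤s (z≤n {k})))

-- The key property: the colours of two consecutive pairs a,b and b,c differ.
-- If they single out the same bit position, the bit of a there differs
-- from the bit of b there.
cvColour-≢ : ∀ k a b c → a < 2 ^ k → b < 2 ^ k → c < 2 ^ k → a ≢ b → b ≢ c →
             cvColour k a b ≢ cvColour k b c
cvColour-≢ zero a b c a< b< c< a≢b _ = ⊥-elim (a≢b (trans (below-1 a<) (sym (below-1 b<))))
cvColour-≢ (suc k) a b c a< b< c< a≢b b≢c with a % 2 ≟ b % 2 | b % 2 ≟ c % 2
... | yes ab | yes bc = λ same →
      cvColour-≢ k (a / 2) (b / 2) (c / 2) (half-< k a<) (half-< k b<) (half-< k c<)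
        (λ high≡ → a≢b (bits-injective a b ab high≡))
        (λ high≡ → b≢c (bits-injective b c bc high≡))
        (suc-injective (suc-injective same))
... | yes _  | no _   = 2+≢bit _ _ (m%n<n b 2)
... | no _   | yes _  = λ same → 2+≢bit _ _ (m%n<n a 2) (sym same)
... | no ab  | no _   = ab

cvRound : ℕ → WindowMap 1
cvRound k = slide₂ (cvColour k)

cvRound-recolours : ∀ k → Recolours (cvRound k) (2 ^ k) (2 * k)
recolour (cvRound-recolours k) {s} proper i =
  cvColour-< k _ _ (below i) (below (suc i)) (distinct i) ,
  cvColour-≢ k _ _ _ (below i) (below (suc i)) (below (suc (suc i))) (distinct i) (distinct (suc i))
  where
  below : ∀ j → s j < 2 ^ k
  below j = proj₁ (proper j)
  distinct : ∀ j → s j ≢ s (suc j)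
  distinct j = proj₂ (proper j)

-- Number of binary digits needed to write the numbers below B.
bits : ℕ → ℕ
bits B = suc ⌊log₂ (B ∸ 1) ⌋

1+-≤-2^ : ∀ k → suc k ≤ 2 ^ k
1+-≤-2^ zero    = s≤s z≤n
1+-≤-2^ (suc k) = subst (2 + k ≤_) (cong (2 ^ k +_) (sym (+-identityʳ (2 ^ k))))
  (+-mono-≤ (≤-trans (s≤s z≤n) (1+-≤-2^ k)) (1+-≤-2^ k))

<-2^1+⌊log₂⌋ : ∀ m → m < 2 ^ suc ⌊log₂ m ⌋
<-2^1+⌊log₂⌋ m with m <? 2 ^ suc ⌊log₂ m ⌋
... | yes m< = m<
... | no  m≮ = ⊥-elim (<-irrefl refl
      (subst (_≤ ⌊log₂ m ⌋) (⌊log₂[2^n]⌋≡n (suc ⌊log₂ m ⌋)) (⌊log₂⌋-mono-≤ (≮⇒≥ m≮))))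

≤-2^bits : ∀ B → B ≤ 2 ^ bits B
≤-2^bits zero    = z≤n
≤-2^bits (suc b) = <-2^1+⌊log₂⌋ b

bits-mono : ∀ {B B′} → B ≤ B′ → bits B ≤ bits B′
bits-mono B≤B′ = s≤s (⌊log₂⌋-mono-≤ (∸-monoˡ-≤ 1 B≤B′))

cvBound : ℕ → ℕ → ℕ
cvBound zero    B = B
cvBound (suc r) B = cvBound r (2 * bits B)

cvRounds : (r : ℕ) → ℕ → WindowMap r
cvRounds zero    B = identity
cvRounds (suc r) B = cvRound (bits B) ⨾ cvRounds r (2 * bits B)

cvRounds-recolours : ∀ r B → Recolours (cvRounds r B) B (cvBound r B)
recolour (cvRounds-recolours zero B) proper = proper
cvRounds-recolours (suc r) B =
  recolours-⨾ (recolours-mono (≤-2^bits B) ≤-refl (cvRound-recolours (bits B)))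
    (cvRounds-recolours r (2 * bits B))

iterLog : ℕ → ℕ → ℕ
iterLog zero    x = x
iterLog (suc r) x = iterLog r ⌊log₂ x ⌋

⌊log₂⌋-< : ∀ k → ⌊log₂ suc k ⌋ < suc k
⌊log₂⌋-< k = s≤s (≤-trans (⌊log₂⌋-mono-≤ (1+-≤-2^ k)) (≤-reflexive (⌊log₂[2^n]⌋≡n k)))

iterLog-log* : ∀ f m → m ≤ f → iterLog (logStar-fuel f m) m ≤ 1
iterLog-log* zero    zero          _   = z≤n
iterLog-log* (suc f) zero          _   = z≤n
iterLog-log* (suc f) (suc zero)    _   = s≤s z≤n
iterLog-log* (suc f) (suc (suc k)) m≤f =
  iterLog-log* f ⌊log₂ suc (suc k) ⌋ (≤-pred (≤-trans (⌊log₂⌋-< (suc k)) m≤f))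

⌊log₂16x⌋ : ∀ y → ⌊log₂ (2 * (2 * (2 * (2 * suc y)))) ⌋ ≡ 4 + ⌊log₂ suc y ⌋
⌊log₂16x⌋ y = begin
  ⌊log₂ (2 * (2 * (2 * (2 * suc y)))) ⌋  ≡⟨ ⌊log₂[2*b]⌋≡1+⌊log₂b⌋ (2 * (2 * (2 * suc y))) ⟩
  1 + ⌊log₂ (2 * (2 * (2 * suc y))) ⌋    ≡⟨ cong suc (⌊log₂[2*b]⌋≡1+⌊log₂b⌋ (2 * (2 * suc y))) ⟩
  2 + ⌊log₂ (2 * (2 * suc y)) ⌋          ≡⟨ cong (2 +_) (⌊log₂[2*b]⌋≡1+⌊log₂b⌋ (2 * suc y)) ⟩
  3 + ⌊log₂ (2 * suc y) ⌋                ≡⟨ cong (3 +_) (⌊log₂[2*b]⌋≡1+⌊log₂b⌋ (suc y)) ⟩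
  4 + ⌊log₂ suc y ⌋                      ∎
  where open ≡-Reasoning

9+2x≤16x : ∀ y → 9 + 2 * suc y ≤ 2 * (2 * (2 * (2 * suc y)))
9+2x≤16x y = begin
  9 + 2 * suc y                   ≤⟨ +-monoˡ-≤ (2 * suc y) (≤-trans (m≤m+n 9 5) (m≤m*n 14 (suc y))) ⟩
  14 * suc y + 2 * suc y          ≡⟨ sixteen (suc y) ⟩
  2 * (2 * (2 * (2 * suc y)))     ∎
  where
  open ≤-Reasoning
  sixteen : ∀ x → 14 * x + 2 * x ≡ 2 * (2 * (2 * (2 * x)))
  sixteen = solve-∀

cvBound-step : ∀ B x → B ≤ 10 + 2 * x → 2 * bits B ≤ 10 + 2 * ⌊log₂ x ⌋
cvBound-step B zero    B≤ = ≤-trans (*-monoʳ-≤ 2 (bits-mono B≤)) (m≤m+n 8 2)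
cvBound-step B (suc y) B≤ = begin
  2 * bits B                    ≤⟨ *-monoʳ-≤ 2 (s≤s (⌊log₂⌋-mono-≤ (≤-trans (∸-monoˡ-≤ 1 B≤) (9+2x≤16x y)))) ⟩
  2 * suc ⌊log₂ (2 * (2 * (2 * (2 * suc y)))) ⌋
                                ≡⟨ cong (λ k → 2 * suc k) (⌊log₂16x⌋ y) ⟩
  2 * (5 + ⌊log₂ suc y ⌋)       ≡⟨ *-distribˡ-+ 2 5 ⌊log₂ suc y ⌋ ⟩
  10 + 2 * ⌊log₂ suc y ⌋        ∎
  where open ≤-Reasoning

cvBound-iterLog : ∀ r B x → B ≤ 10 + 2 * x → cvBound r B ≤ 10 + 2 * iterLog r x
cvBound-iterLog zero    B x B≤ = B≤
cvBound-iterLog (suc r) B x B≤ = cvBound-iterLog r (2 * bits B) ⌊log₂ x ⌋ (cvBound-step B x B≤)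

cvBound-log* : ∀ n → cvBound (log* n) n ≤ 12
cvBound-log* n = ≤-trans (cvBound-iterLog (log* n) n n n≤10+2n)
                         (+-monoʳ-≤ 10 (*-monoʳ-≤ 2 (iterLog-log* n n ≤-refl)))
  where
  n≤10+2n : n ≤ 10 + 2 * n
  n≤10+2n = ≤-trans (m≤m+n n (n + 0)) (m≤n+m (2 * n) 10)

-- Two final rounds: 12 → 8 → 6 colours.
cvBound-finish : ∀ B → B ≤ 12 → cvBound 2 B ≤ 6
cvBound-finish B B≤12 = *-monoʳ-≤ 2 (bits-mono (*-monoʳ-≤ 2 (bits-mono B≤12)))

avoid : ℕ → ℕ → ℕ
avoid zero          zero          = 1
avoid zero          (suc zero)    = 2
avoid zero          (suc (suc _)) = 1
avoid (suc zero)    zero          = 2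
avoid (suc (suc _)) zero          = 1
avoid (suc zero)    (suc _)       = 0
avoid (suc (suc _)) (suc _)       = 0

avoid-spec : ∀ a b → avoid a b < 3 × avoid a b ≢ a × avoid a b ≢ b
avoid-spec zero          zero          = s≤s (s≤s z≤n) , (λ ()) , (λ ())
avoid-spec zero          (suc zero)    = ≤-refl , (λ ()) , (λ ())
avoid-spec zero          (suc (suc _)) = s≤s (s≤s z≤n) , (λ ()) , (λ ())
avoid-spec (suc zero)    zero          = ≤-refl , (λ ()) , (λ ())
avoid-spec (suc (suc _)) zero          = s≤s (s≤s z≤n) , (λ ()) , (λ ())
avoid-spec (suc zero)    (suc _)       = s≤s z≤n , (λ ()) , (λ ())
avoid-spec (suc (suc _)) (suc _)       = s≤s z≤n , (λ ()) , (λ ())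

dropRule : ℕ → ℕ → ℕ → ℕ → ℕ
dropRule x a b c with b ≟ x
... | yes _ = avoid a c
... | no  _ = b

dropRule-< : ∀ {x} a b c → 3 ≤ x → b < suc x → dropRule x a b c < x
dropRule-< {x} a b c 3≤x b<1+x with b ≟ x
... | yes _   = ≤-trans (proj₁ (avoid-spec a c)) 3≤x
... | no  b≢x = ≤∧≢⇒< (≤-pred b<1+x) b≢x

-- Only b ≢ c is needed: a recoloured entry avoids its neighbour, and two
-- adjacent entries are never both recoloured.
dropRule-≢ : ∀ {x} a b c d → b ≢ c → dropRule x a b c ≢ dropRule x b c d
dropRule-≢ {x} a b c d b≢c with b ≟ x | c ≟ x
... | yes b≡x | yes c≡x = ⊥-elim (b≢c (trans b≡x (sym c≡x)))
... | yes _   | no  _   = proj₂ (proj₂ (avoid-spec a c))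
... | no  _   | yes _   = λ same → proj₁ (proj₂ (avoid-spec b d)) (sym same)
... | no  _   | no  _   = b≢c

dropColour : ℕ → WindowMap 2
dropColour x = slide₃ (dropRule x)

dropColour-recolours : ∀ x → 3 ≤ x → Recolours (dropColour x) (suc x) x
recolour (dropColour-recolours x 3≤x) {s} proper i =
  dropRule-< (s i) _ _ 3≤x (proj₁ (proper (suc i))) ,
  dropRule-≢ (s i) _ _ _ (proj₂ (proper (suc i)))

sixToThree : WindowMap 6
sixToThree = dropColour 5 ⨾ dropColour 4 ⨾ dropColour 3

sixToThree-recolours : Recolours sixToThree 6 3
sixToThree-recolours =
  recolours-⨾ (dropColour-recolours 5 (m≤m+n 3 2))
    (recolours-⨾ (dropColour-recolours 4 (n≤1+n 3)) (dropColour-recolours 3 ≤-refl))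

-- Opaque: the composed map is never unfolded by the type checker (doing
-- so evaluates the colour rules symbolically); only its properties are used.
opaque
  -- log* n + 2 Cole–Vishkin rounds (n → 12 → 8 → 6 colours), then 6 → 3.
  streamColouring : (n : ℕ) → WindowMap (log* n + 8)
  streamColouring n = cvRounds (log* n) n ⨾ cvRounds 2 (cvBound (log* n) n) ⨾ sixToThree

  streamColouring-recolours : ∀ n → Recolours (streamColouring n) n 3
  streamColouring-recolours n =
    recolours-⨾ (cvRounds-recolours (log* n) n)
      (recolours-⨾ (recolours-mono ≤-refl (cvBound-finish B (cvBound-log* n)) (cvRounds-recolours 2 B))
                   sixToThree-recolours)
    where
    B : ℕ
    B = cvBound (log* n) n

toFin3 : ℕ → Fin 3
toFin3 zero                = zero
toFin3 (suc zero)          = suc zero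
toFin3 (suc (suc _))       = suc (suc zero)

toℕ-toFin3 : ∀ {a} → a < 3 → toℕ (toFin3 a) ≡ a
toℕ-toFin3 {zero}                _ = refl
toℕ-toFin3 {suc zero}            _ = refl
toℕ-toFin3 {suc (suc zero)}      _ = refl
toℕ-toFin3 {suc (suc (suc _))}   (s≤s (s≤s (s≤s ())))

toFin3-injective : ∀ {a b} → a < 3 → b < 3 → toFin3 a ≡ toFin3 b → a ≡ b
toFin3-injective a<3 b<3 same =
  trans (sym (toℕ-toFin3 a<3)) (trans (cong toℕ same) (toℕ-toFin3 b<3))

-- Read a probe answer as a vertex ID; u is a default for invalid answers.
toVertex : ∀ {n} → Fin n → Maybe ℕ → Fin n
toVertex {n} u (just m) with m <? n
... | yes m<n = fromℕ< m<n
... | no  _   = u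
toVertex u nothing = u

toVertex-toℕ : ∀ {n} (u w : Fin n) → toVertex u (just (toℕ w)) ≡ w
toVertex-toℕ {n} u w with toℕ w <? n
... | yes w<n = toℕ-injective (toℕ-fromℕ< w<n)
... | no  w≮n = ⊥-elim (w≮n (toℕ<n w))

-- The successor of u is its neighbour at the first port (u itself if u
-- is isolated); it is determined by the single probe of cell (u , 1).
successor : ∀ {n} → Graph n → Fin n → Fin n
successor G u = toVertex u (cell G u 1)

module _ {n} (G : Graph n) where

  successor-neighbour : ∀ u → deg G u ≢ 0 → ∃ λ i → successor G u ≡ nbr G u i
  successor-neighbour u nz with 0 <? deg G u
  ... | yes 0<deg = fromℕ< 0<deg , toVertex-toℕ u _
  ... | no  0≮deg = ⊥-elim (0≮deg (n≢0⇒n>0 nz))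

  successor-≢ : ∀ u → deg G u ≢ 0 → successor G u ≢ u
  successor-≢ u nz with successor-neighbour u nz
  ... | i , succ≡nbr rewrite succ≡nbr = no-loop G u i

  successor-non-isolated : ∀ u → deg G u ≢ 0 → deg G (successor G u) ≢ 0
  successor-non-isolated u nz with successor-neighbour u nz
  ... | i , succ≡nbr rewrite succ≡nbr = nonempty (proj₁ (sym-adj G u i))
    where
    nonempty : ∀ {m} → Fin m → m ≢ 0
    nonempty {suc _} _ ()

  walk : ℕ → Fin n → Fin n
  walk zero    u = u
  walk (suc i) u = walk i (successor G u)

  -- The IDs met when following successors from v.  Note that
  -- trail (successor G v) is shift (trail v) by definition.
  trail : Fin n → Stream
  trail v i = toℕ (walk i v)

  trail-proper : ∀ v → deg G v ≢ 0 → Proper n (trail v)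
  trail-proper v nz zero    = toℕ<n v , λ same → successor-≢ v nz (sym (toℕ-injective same))
  trail-proper v nz (suc i) = trail-proper (successor G v) (successor-non-isolated v nz) i

mapTree : ∀ {n A B} → (A → B) → ProbeTree n A → ProbeTree n B
mapTree f (answer a)    = answer (f a)
mapTree f (probe v j k) = probe v j (λ r → mapTree f (k r))

run-mapTree : ∀ {n A B} (f : A → B) t (G : Graph n) → run (mapTree f t) G ≡ f (run t G)
run-mapTree f (answer a)    G = refl
run-mapTree f (probe v j k) G = run-mapTree f (k (cell G v j)) G

probes-mapTree : ∀ {n A B} (f : A → B) t (G : Graph n) → probes (mapTree f t) G ≡ probes t G
probes-mapTree f (answer a)    G = refl
probes-mapTree f (probe v j k) G = cong suc (probes-mapTree f (k (cell G v j)) G)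

_∷ₛ_ : ℕ → Stream → Stream
(x ∷ₛ s) zero    = x
(x ∷ₛ s) (suc i) = s i

readTrail : ∀ {n} → ℕ → Fin n → ProbeTree n Stream
readTrail zero    u = answer (λ _ → toℕ u)
readTrail (suc L) u = probe u 1 (λ r → mapTree (toℕ u ∷ₛ_) (readTrail L (toVertex u r)))

run-readTrail : ∀ {n} (G : Graph n) L u → Agree L (run (readTrail L u) G) (trail G u)
run-readTrail G zero    u zero    _ = refl
run-readTrail G (suc L) u i       i≤ =
  trans (cong (λ s → s i) (run-mapTree (toℕ u ∷ₛ_) (readTrail L (successor G u)) G)) (entry i i≤)
  where
  entry : ∀ i → i ≤ suc L → (toℕ u ∷ₛ run (readTrail L (successor G u)) G) i ≡ trail G u i
  entry zero    _        = refl
  entry (suc i) (s≤s i≤) = run-readTrail G L (successor G u) i i≤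

probes-readTrail : ∀ {n} (G : Graph n) L u → probes (readTrail L u) G ≡ L
probes-readTrail G zero    u = refl
probes-readTrail G (suc L) u = cong suc (trans
  (probes-mapTree (toℕ u ∷ₛ_) (readTrail L (successor G u)) G)
  (probes-readTrail G L (successor G u)))

colourOf : (n : ℕ) → Stream → Fin 3
colourOf n s = toFin3 (apply (streamColouring n) s 0)

lca : ColoringLCA 3
lca n v = mapTree (colourOf n) (readTrail (log* n + 8) v)

-- By locality the answer is the colour of the full trail of v.
lca-colour : ∀ {n} (G : Graph n) v → lcaColoring lca G v ≡ colourOf n (trail G v)
lca-colour {n} G v = trans (run-mapTree (colourOf n) (readTrail (log* n + 8) v) G)
  (cong toFin3 (window-head (streamColouring n) (run-readTrail G (log* n + 8) v)))

lca-probes : ∀ {n} (G : Graph n) v → probes (lca n v) G ≡ log* n + 8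
lca-probes {n} G v = trans (probes-mapTree (colourOf n) (readTrail (log* n + 8) v) G)
  (probes-readTrail G (log* n + 8) v)

-- A non-isolated vertex and its successor get different colours: their
-- trails are a stream and its shift, which the proper colouring
-- separates.
successor-colour : ∀ {n} (G : Graph n) v → deg G v ≢ 0 →
                   lcaColoring lca G (successor G v) ≢ lcaColoring lca G v
successor-colour {n} G v nz same =
  proj₂ (proper 0) (sym (toFin3-injective (proj₁ (proper 1)) (proj₁ (proper 0)) (begin
    toFin3 (colours 1)                     ≡⟨ cong toFin3 (sym (equivariant (streamColouring n) (trail G v) 0)) ⟩
    colourOf n (trail G (successor G v))   ≡⟨ sym (lca-colour G (successor G v)) ⟩
    lcaColoring lca G (successor G v)      ≡⟨ same ⟩
    lcaColoring lca G v                    ≡⟨ lca-colour G v ⟩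
    toFin3 (colours 0)                     ∎)))
  where
  open ≡-Reasoning
  colours : Stream
  colours = apply (streamColouring n) (trail G v)
  proper : Proper 3 colours
  proper = recolour (streamColouring-recolours n) (trail-proper G v nz)

theorem1 : ∃ λ (C : ℕ) → Σ (ColoringLCA 3) λ L →
    ∀ (n : ℕ) (G : Graph n) →
    IsWeakColoring G (lcaColoring L G) ×
    (∀ (v : Fin n) → probes (L n v) G ≤ log* n + C)
theorem1 = 8 , lca , λ n G → weak G , λ v → ≤-reflexive (lca-probes G v)
  where
  weak : ∀ {n} (G : Graph n) → IsWeakColoring G (lcaColoring lca G)
  weak G v nz with successor-neighbour G v nz
  ... | i , succ≡nbr =
    i , subst (λ u → lcaColoring lca G u ≢ lcaColoring lca G v) succ≡nbr (successor-colour G v nz)
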